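{- Let $\mathcal M=\langle(\mathcal C_i)_{i\in I},(\mathcal B_i)_{i\in I},(R_j)_{j\in J}\rangle$ be a model and $\mathcal G\in|\mathcal M|$. Then there exist a set $\mathcal X_{\mathcal G}\subseteq\mathcal T^{<\omega}$ and $i\in I$ such that $\mathcal G=\mathcal X_{\mathcal G}\leadsto\mathcal B_i$.
   Context: $\lambda\mu$-terms over disjoint infinite sets of $\lambda$-variables and $\mu$-variables: $t ::= x \mid \lambda x.t \mid (t\,t) \mid \mu\alpha.t \mid (\alpha\,t)$. $u[\alpha:=^*v]$ replaces inductively each subterm $(\alpha\,w)$ of $u$ by $(\alpha\,(w\,v))$. Reduction $\triangleright$: compatible closure of $(\lambda x.u\;v)\triangleright u[x:=v]$ and $(\mu\alpha.u\;v)\triangleright\mu\alpha.u[\alpha:=^*v]$; $\triangleright^*$ its reflexive transitive closure. $\mathcal T$ = set of terms, $\mathcal T^{<\omega}$ = set of finite sequences of terms (including the empty sequence); $(t\,\bar u)=(\dots(t\,u_1)\dots u_n)$, $(t\,\emptyset)=t$. A set $\mathcal S$ of terms is saturated if $v\triangleright^*u$ and $u\in\mathcal S$ imply $v\in\mathcal S$. For sets of terms $\mathcal K,\mathcal L$: $\mathcal K\leadsto\mathcal L=\{t\mid\forall u\in\mathcal K,(t\,u)\in\mathcal L\}$; for $\mathcal X\subseteq\mathcal T^{<\omega}$: $\mathcal X\leadsto\mathcal L=\{t\mid\forall\bar u\in\mathcal X,(t\,\bar u)\in\mathcal L\}$. A model $\mathcal M=\langle(\mathcal C_i)_{i\in I},(\mathcal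 B_i)_{i\in I},(R_j)_{j\in J}\rangle$: $I,J\subseteq\mathbb N$ with $0\in I$; the $\mathcal C_i$ are pairwise disjoint infinite sets of $\mu$-variables; the $\mathcal B_i$ and $R_j$ are non-empty saturated sets of terms; for all $i\in I$, if $\alpha\in\mathcal C_i$ and $u\in\mathcal B_0$ then $\mu\alpha.u\in\mathcal B_i$, and if $\alpha\in\mathcal C_i$ and $u\in\mathcal B_i$ then $(\alpha\,u)\in\mathcal B_0$; for every $j\in J$ there exist $i\in I$ and $\mathcal X_j\subseteq\mathcal T^{<\omega}$ with $R_j=\mathcal X_j\leadsto\mathcal B_i$. $|\mathcal M|$ is the smallest set containing all $\mathcal B_i$ and all $R_j$ and closed under the binary operation $\leadsto$ on sets of terms. -}

module Defs where

open import Level using (0ℓ)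
open import Data.Nat using (ℕ; zero; suc; _⊔_; _≟_; _≤_)
open import Data.List using (List; []; _∷_; foldl)
open import Data.Product using (Σ; _×_; _,_; ∃)
open import Data.Empty using (⊥)
open import Relation.Nullary using (¬_; yes; no)
open import Relation.Unary using (Pred; _∈_; _⊆_; _≐_)
open import Relation.Binary.PropositionalEquality using (_≡_)
open import Relation.Binary.Construct.Closure.ReflexiveTransitive using (Star)

-- λμ-terms (named syntax).  λ-variables and μ-variables are both coded
-- by natural numbers, but live in separate syntactic positions, so the
-- two sets of variables are disjoint.

data Term : Set where
  var   : ℕ → Term
  lam   : ℕ → Term → Term
  app   : Term → Term → Term
  mu    : ℕ → Term → Term
  named : ℕ → Term → Term

-- size, used as fuel for capture-avoiding substitution
size : Term → ℕ
size (var x)     = 1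
size (lam x t)   = suc (size t)
size (app t u)   = suc (size t ⊔ size u)
size (mu a t)    = suc (size t)
size (named a t) = suc (size t)

maxV : Term → ℕ
maxV (var x)     = x
maxV (lam x t)   = x ⊔ maxV t
maxV (app t u)   = maxV t ⊔ maxV u
maxV (mu a t)    = a ⊔ maxV t
maxV (named a t) = a ⊔ maxV t

-- renaming of a free λ-variable y to z (z assumed fresh)
renλ : Term → ℕ → ℕ → Term
renλ (var x) y z with x ≟ y
... | yes _ = var z
... | no  _ = var x
renλ (lam x t) y z with x ≟ y
... | yes _ = lam x t
... | no  _ = lam x (renλ t y z)
renλ (app t u) y z   = app (renλ t y z) (renλ u y z)
renλ (mu a t) y z    = mu a (renλ t y z)
renλ (named a t) y z = named a (renλ t y z)

-- renaming of a free μ-variable β to γ (γ assumed fresh)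
renμ : Term → ℕ → ℕ → Term
renμ (var x) b c     = var x
renμ (lam x t) b c   = lam x (renμ t b c)
renμ (app t u) b c   = app (renμ t b c) (renμ u b c)
renμ (mu a t) b c with a ≟ b
... | yes _ = mu a t
... | no  _ = mu a (renμ t b c)
renμ (named a t) b c with a ≟ b
... | yes _ = named c (renμ t b c)
... | no  _ = named a (renμ t b c)

-- capture-avoiding substitution u[x:=v]; every binder met is renamed
-- to a variable fresh for the whole situation (fuel = size, renaming
-- preserves size).
substF : ℕ → Term → ℕ → Term → Term
substF zero    u x v = u
substF (suc n) (var y) x v with y ≟ x
... | yes _ = v
... | no  _ = var y
substF (suc n) (lam y t) x v with y ≟ x
... | yes _ = lam y t
... | no  _ = let z = suc (maxV (lam y t) ⊔ x ⊔ maxV v)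
              in lam z (substF n (renλ t y z) x v)
substF (suc n) (app t u) x v = app (substF n t x v) (substF n u x v)
substF (suc n) (mu a t) x v =
  let c = suc (maxV (mu a t) ⊔ x ⊔ maxV v)
  in mu c (substF n (renμ t a c) x v)
substF (suc n) (named a t) x v = named a (substF n t x v)

_[_:=_] : Term → ℕ → Term → Term
u [ x := v ] = substF (size u) u x v

msubstF : ℕ → Term → ℕ → Term → Term
msubstF zero    u a v = u
msubstF (suc n) (var y) a v = var y
msubstF (suc n) (lam y t) a v =
  let z = suc (maxV (lam y t) ⊔ a ⊔ maxV v)
  in lam z (msubstF n (renλ t y z) a v)
msubstF (suc n) (app t u) a v = app (msubstF n t a v) (msubstF n u a v)
msubstF (suc n) (mu b t) a v with b ≟ a
... | yes _ = mu b t
... | no  _ = let c = suc (maxV (mu b t) ⊔ a ⊔ maxV v)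
              in mu c (msubstF n (renμ t b c) a v)
msubstF (suc n) (named b t) a v with b ≟ a
... | yes _ = named b (app (msubstF n t a v) v)
... | no  _ = named b (msubstF n t a v)

_[_:=*_] : Term → ℕ → Term → Term
u [ a :=* v ] = msubstF (size u) u a v

infix 4 _▷_ _▷*_
data _▷_ : Term → Term → Set where
  β     : ∀ {x u v} → app (lam x u) v ▷ (u [ x := v ])
  μ     : ∀ {a u v} → app (mu a u) v ▷ mu a (u [ a :=* v ])
  ξlam  : ∀ {x t t'} → t ▷ t' → lam x t ▷ lam x t'
  ξappl : ∀ {t t' u} → t ▷ t' → app t u ▷ app t' u
  ξappr : ∀ {t u u'} → u ▷ u' → app t u ▷ app t u'
  ξmu   : ∀ {a t t'} → t ▷ t' → mu a t ▷ mu a t'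
  ξnam  : ∀ {a t t'} → t ▷ t' → named a t ▷ named a t'

_▷*_ : Term → Term → Set
_▷*_ = Star _▷_

TSet : Set₁
TSet = Pred Term 0ℓ

appSeq : Term → List Term → Term
appSeq t us = foldl app t us

Saturated : TSet → Set
Saturated S = ∀ {u v} → v ▷* u → u ∈ S → v ∈ S

NonEmpty : TSet → Set
NonEmpty S = ∃ λ t → t ∈ S

infixr 5 _⇝_ _⇝*_
_⇝_ : TSet → TSet → TSet
(K ⇝ L) t = ∀ u → u ∈ K → app t u ∈ L

_⇝*_ : Pred (List Term) 0ℓ → TSet → TSet
(X ⇝* L) t = ∀ us → us ∈ X → appSeq t us ∈ L

record Model : Set₁ where
  field
    I J  : Pred ℕ 0ℓ
    0∈I  : 0 ∈ I
    C    : ℕ → Pred ℕ 0ℓ          -- C i : a set of μ-variables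
    B    : ℕ → TSet
    R    : ℕ → TSet
    C-disjoint : ∀ {i k} → i ∈ I → k ∈ I → ¬ (i ≡ k) →
                 ∀ a → a ∈ C i → a ∈ C k → ⊥
    C-infinite : ∀ {i} → i ∈ I → ∀ n → ∃ λ a → n ≤ a × a ∈ C i
    B-nonempty : ∀ {i} → i ∈ I → NonEmpty (B i)
    B-saturated : ∀ {i} → i ∈ I → Saturated (B i)
    R-nonempty : ∀ {j} → j ∈ J → NonEmpty (R j)
    R-saturated : ∀ {j} → j ∈ J → Saturated (R j)
    mu-B  : ∀ {i} → i ∈ I → ∀ {a u} → a ∈ C i → u ∈ B 0 → mu a u ∈ B i
    nam-B : ∀ {i} → i ∈ I → ∀ {a u} → a ∈ C i → u ∈ B i → named a u ∈ B 0
    R-form : ∀ {j} → j ∈ J →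
             Σ ℕ λ i → i ∈ I × Σ (Pred (List Term) 0ℓ) λ X → R j ≐ (X ⇝* B i)

data ∣_∣ (M : Model) : TSet → Set₁ where
  inB   : ∀ {G} i → i ∈ Model.I M → G ≐ Model.B M i → ∣ M ∣ G
  inR   : ∀ {G} j → j ∈ Model.J M → G ≐ Model.R M j → ∣ M ∣ G
  inArr : ∀ {G K L} → ∣ M ∣ K → ∣ M ∣ L → G ≐ (K ⇝ L) → ∣ M ∣ G

module Submission where

-- Call such a G "B-representable".  The proof is an induction on the
-- derivation of G ∈ |M|, using three facts about _⇝*_ that hold for any
-- target set L:
--   * L itself is {∅} ⇝* L, since (t ∅) = t;
--   * K ⇝ (X ⇝* L) is (K·X) ⇝* L, where K·X is the set of sequences
--     u ∷ ū with u ∈ K and ū ∈ X (currying, as (t u ū) = ((t u) ū));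
--   * _⇝_ respects extensional equality in its second argument.
-- The generators B i are then representable by the first fact, the R j
-- are representable by the defining property of a model, and closure
-- under _⇝_ follows from the second and third facts; representability
-- is transported along the extensional equalities of the derivation.

open import Defs
open import Data.Nat using (ℕ)
open import Data.List using (List; []; _∷_)
open import Data.Product using (Σ; _×_; _,_)
open import Data.Empty using (⊥)
open import Level using (0ℓ)
open import Relation.Unary using (Pred; _∈_; _≐_)
open import Relation.Unary.Properties using (≐-trans)
open import Relation.Binary.PropositionalEquality using (_≡_; refl)

EmptySeq : Pred (List Term) 0ℓ
EmptySeq us = us ≡ []

_·_ : TSet → Pred (List Term) 0ℓ → Pred (List Term) 0ℓ
(K · X) []       = ⊥
(K · X) (u ∷ us) = u ∈ K × us ∈ X

⇝*-EmptySeq : (L : TSet) → L ≐ (EmptySeq ⇝* L)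
⇝*-EmptySeq L = (λ t∈L → λ { [] refl → t∈L }) , (λ t∈∅⇝L → t∈∅⇝L [] refl)

⇝-curry : (K : TSet) (X : Pred (List Term) 0ℓ) (L : TSet) →
          (K ⇝ (X ⇝* L)) ≐ ((K · X) ⇝* L)
⇝-curry K X L =
  (λ t∈K⇝X⇝L → λ { [] () ; (u ∷ us) (u∈K , us∈X) → t∈K⇝X⇝L u u∈K us us∈X }) ,
  (λ t∈KX⇝L u u∈K us us∈X → t∈KX⇝L (u ∷ us) (u∈K , us∈X))

⇝-respʳ-≐ : (K : TSet) {L L′ : TSet} → L ≐ L′ → (K ⇝ L) ≐ (K ⇝ L′)
⇝-respʳ-≐ K (L⊆L′ , L′⊆L) =
  (λ t∈K⇝L u u∈K → L⊆L′ (t∈K⇝L u u∈K)) ,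
  (λ t∈K⇝L′ u u∈K → L′⊆L (t∈K⇝L′ u u∈K))

BRepresentable : Model → TSet → Set₁
BRepresentable M G =
  Σ (Pred (List Term) 0ℓ) λ X → Σ ℕ λ i → i ∈ Model.I M × G ≐ (X ⇝* Model.B M i)

B-BRepresentable : (M : Model) {i : ℕ} → i ∈ Model.I M → BRepresentable M (Model.B M i)
B-BRepresentable M {i} i∈I = EmptySeq , i , i∈I , ⇝*-EmptySeq (Model.B M i)

R-BRepresentable : (M : Model) {j : ℕ} → j ∈ Model.J M → BRepresentable M (Model.R M j)
R-BRepresentable M j∈J with Model.R-form M j∈J
... | i , i∈I , X , Rj≐X⇝B = X , i , i∈I , Rj≐X⇝B

BRepresentable-resp-≐ : (M : Model) {G H : TSet} →
                        G ≐ H → BRepresentable M H → BRepresentable M G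
BRepresentable-resp-≐ M G≐H (X , i , i∈I , H≐X⇝B) = X , i , i∈I , ≐-trans G≐H H≐X⇝B

BRepresentable-⇝ : (M : Model) (K : TSet) {L : TSet} →
                   BRepresentable M L → BRepresentable M (K ⇝ L)
BRepresentable-⇝ M K (X , i , i∈I , L≐X⇝B) =
  K · X , i , i∈I , ≐-trans (⇝-respʳ-≐ K L≐X⇝B) (⇝-curry K X (Model.B M i))

lemma2p14 : (M : Model) → (G : TSet) → ∣ M ∣ G →
    Σ (Pred (List Term) 0ℓ) λ X → Σ ℕ λ i → i ∈ Model.I M × G ≐ (X ⇝* Model.B M i)
lemma2p14 M G (inB i i∈I G≐Bi) =
  BRepresentable-resp-≐ M G≐Bi (B-BRepresentable M i∈I)
lemma2p14 M G (inR j j∈J G≐Rj) =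
  BRepresentable-resp-≐ M G≐Rj (R-BRepresentable M j∈J)
lemma2p14 M G (inArr {K = K} {L = L} _ L∈M G≐K⇝L) =
  BRepresentable-resp-≐ M G≐K⇝L (BRepresentable-⇝ M K (lemma2p14 M L L∈M))
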